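{- Let $G$ and $H$ be finite simple graphs, and let $G\circ H$ denote their corona product. If $H$ has a perfect matching, then \[\nu(G\circ H)= \nu(G) + n(G)\,\nu(H),\] and if $H$ has no perfect matching, then \[\nu(G \circ H)= n(G) + n(G)\,\nu(H).\]
   Context: For a graph $X$, $n(X)$ denotes its number of vertices and $\nu(X)$ its matching number (the maximum size of a matching, i.e. of a set of pairwise non-adjacent edges). A perfect matching is a matching saturating every vertex. The corona product $G\circ H$, where $V(G)=\{g_1,\dots,g_{n(G)}\}$, is obtained from the disjoint union of $G$ and $n(G)$ copies $H_1,\dots,H_{n(G)}$ of $H$ by joining, for each $i$, the vertex $g_i$ to every vertex of $H_i$. -}

module Defs where

open import Data.Nat using (ℕ; _≤_; _+_; _*_)
open import Data.Fin using (Fin)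
open import Data.Product using (_×_; _,_; Σ; ∃-syntax; proj₁; proj₂)
open import Data.Sum using (_⊎_; inj₁; inj₂)
open import Data.List using (List; []; _∷_; length; concatMap)
open import Data.List.Relation.Unary.All using (All)
open import Data.List.Relation.Unary.Any using (Any)
open import Data.List.Relation.Unary.Unique.Propositional using (Unique)
open import Data.List.Membership.Propositional using (_∈_)
open import Relation.Binary.PropositionalEquality using (_≡_; refl) renaming (sym to ≡-sym)
open import Relation.Nullary using (¬_)

record SimpleGraph (V : Set) : Set₁ where
  field
    Adj   : V → V → Set
    adjSym : ∀ {x y} → Adj x y → Adj y x
    irrefl : ∀ {x} → ¬ Adj x x

open SimpleGraph public

FinGraph : ℕ → Set₁
FinGraph n = SimpleGraph (Fin n)

endpoints : {V : Set} → List (V × V) → List V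
endpoints = concatMap (λ e → proj₁ e ∷ proj₂ e ∷ [])

-- A matching: a list of edges of the graph whose endpoints are pairwise
-- distinct (so the edges are pairwise disjoint and no edge is repeated).
-- Its size is its length.
IsMatching : {V : Set} → SimpleGraph V → List (V × V) → Set
IsMatching G M = All (λ e → Adj G (proj₁ e) (proj₂ e)) M × Unique (endpoints M)

IsMatchingNumber : {V : Set} → SimpleGraph V → ℕ → Set
IsMatchingNumber G k =
  (∃[ M ] (IsMatching G M × length M ≡ k)) ×
  (∀ M → IsMatching G M → length M ≤ k)

HasPerfectMatching : {V : Set} → SimpleGraph V → Set
HasPerfectMatching {V} G = ∃[ M ] (IsMatching G M × (∀ (v : V) → v ∈ endpoints M))

-- Corona product G ∘ H. Vertices: inj₁ i is g_i, inj₂ (i , h) is vertex h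
-- of the i-th copy H_i of H.
coronaAdj : ∀ {n m} → FinGraph n → FinGraph m →
            Fin n ⊎ (Fin n × Fin m) → Fin n ⊎ (Fin n × Fin m) → Set
coronaAdj G H (inj₁ a) (inj₁ b) = Adj G a b
coronaAdj G H (inj₁ a) (inj₂ (i , h)) = a ≡ i
coronaAdj G H (inj₂ (i , h)) (inj₁ a) = i ≡ a
coronaAdj G H (inj₂ (i , h)) (inj₂ (j , h')) = i ≡ j × Adj H h h'

coronaSym : ∀ {n m} (G : FinGraph n) (H : FinGraph m) {x y} →
            coronaAdj G H x y → coronaAdj G H y x
coronaSym G H {inj₁ a} {inj₁ b} p = adjSym G p
coronaSym G H {inj₁ a} {inj₂ _} p = ≡-sym p
coronaSym G H {inj₂ _} {inj₁ a} p = ≡-sym p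
coronaSym G H {inj₂ _} {inj₂ _} (p , q) =
  ≡-sym p , adjSym H q

coronaIrrefl : ∀ {n m} (G : FinGraph n) (H : FinGraph m) {x} → ¬ coronaAdj G H x x
coronaIrrefl G H {inj₁ a} p = irrefl G p
coronaIrrefl G H {inj₂ _} (_ , q) = irrefl H q

corona : ∀ {n m} → FinGraph n → FinGraph m → SimpleGraph (Fin n ⊎ (Fin n × Fin m))
corona G H = record { Adj = coronaAdj G H ; adjSym = λ {x} {y} → coronaSym G H {x} {y} ; irrefl = λ {x} → coronaIrrefl G H {x} }

-- Classify the edges of a matching of G ∘ H by the copy of H they touch.
-- Edges inside a block {g_k} ∪ H_k form a matching of the cone over H, on
-- n(H) + 1 vertices; if H has a perfect matching n(H) = 2ν(H), so a block
-- carries at most ν(H) edges, and the remaining edges form a matching of G.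
-- Otherwise count the edges meeting V(G) (at most n(G), one per vertex g_k)
-- and the edges inside the copies (at most ν(H) each). Both bounds are
-- attained: a maximum matching of G plus one of each H_k in the first case,
-- and in the second a maximum matching of each H_k together with an edge
-- from g_k to a vertex of H_k it leaves unsaturated.
module Submission where

open import Defs
open import Data.Nat using (ℕ; _+_; _*_)
open import Relation.Nullary using (¬_)
open import Data.Product using (_×_)

open import Data.Nat using (zero; suc; _≤_; z≤n; s≤s)
open import Data.Nat.Properties
  using (≤-trans; ≤-pred; +-mono-≤; *-monoʳ-≤; +-suc; *-suc; *-cancelˡ-<; module ≤-Reasoning)
open import Data.Empty using (⊥; ⊥-elim)
open import Data.Unit using (⊤; tt)
open import Data.Fin using (Fin; zero; suc)
open import Data.Fin.Properties using (injective⇒≤; ¬∀⟶∃¬; suc-injective) renaming (_≟_ to _≟ᶠ_)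
open import Data.Nat.ListAction using (sum)
open import Data.Maybe using (Maybe; nothing; just; maybe′)
open import Data.Maybe.Properties using (≡-dec)
open import Data.Product using (∃-syntax; _,_; proj₁; proj₂)
import Data.Product as Prod
open import Data.Sum using (_⊎_; inj₁; inj₂)
open import Data.List using (List; []; _∷_; length; map; _++_; filter; lookup; allFin; cartesianProductWith)
open import Data.List.Properties
  using (length-map; length-++; length-tabulate; map-∘; concatMap-map; map-concatMap; concatMap-++)
open import Data.List.Relation.Unary.All using (All; []; _∷_)
import Data.List.Relation.Unary.All as All
import Data.List.Relation.Unary.All.Properties as All
open import Data.List.Relation.Unary.Any using (here; there)
open import Data.List.Relation.Unary.Unique.Propositional using (Unique; []; _∷_)
import Data.List.Relation.Unary.Unique.Propositional.Properties as Unique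
open import Data.List.Relation.Binary.Disjoint.Propositional using (Disjoint)
open import Data.List.Relation.Binary.Sublist.Propositional using (_⊆_; []; _∷_; _∷ʳ_; ⊆-trans)
open import Data.List.Relation.Binary.Sublist.Propositional.Properties using (filter-⊆; All-resp-⊆)
open import Data.List.Membership.Propositional using (_∈_; _∉_)
open import Data.List.Membership.Propositional.Properties
  using (∈-lookup; ∈-map⁺; ∈-map⁻; ∈-allFin; ∈-cartesianProductWith⁻)
import Data.List.Membership.DecPropositional as DecMembership
import Data.List.Membership.Setoid.Properties as SetoidMembership
open import Relation.Nullary using (Dec; yes; no; ¬?)
open import Relation.Binary.Definitions using (DecidableEquality)
open import Relation.Binary.PropositionalEquality
open import Function using (_∘_; id)

private
  variable
    A B V W I : Set
    p : ℕ

map-preimage : (f : A → B) {ys : List B} → All (λ y → ∃[ x ] f x ≡ y) ys →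
               ∃[ xs ] map f xs ≡ ys
map-preimage f [] = [] , refl
map-preimage f ((x , refl) ∷ pre) with map-preimage f pre
... | xs , refl = x ∷ xs , refl

Unique-resp-⊇ : {xs ys : List A} → xs ⊆ ys → Unique ys → Unique xs
Unique-resp-⊇ []         []        = []
Unique-resp-⊇ (y ∷ʳ τ)   (_ ∷ u)   = Unique-resp-⊇ τ u
Unique-resp-⊇ (refl ∷ τ) (y∉ ∷ u)  = All-resp-⊆ τ y∉ ∷ Unique-resp-⊇ τ u

Unique⇒lookup-injective : {xs : List A} → Unique xs →
                          ∀ {i j} → lookup xs i ≡ lookup xs j → i ≡ j
Unique⇒lookup-injective (_ ∷ _)  {zero}  {zero}  _  = refl
Unique⇒lookup-injective (x∉ ∷ _) {zero}  {suc j} eq = ⊥-elim (All.lookup x∉ (∈-lookup j) eq)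
Unique⇒lookup-injective (x∉ ∷ _) {suc i} {zero}  eq = ⊥-elim (All.lookup x∉ (∈-lookup i) (sym eq))
Unique⇒lookup-injective (_ ∷ u)  {suc i} {suc j} eq = cong suc (Unique⇒lookup-injective u eq)

Unique⇒length≤ : {xs : List (Fin p)} → Unique xs → length xs ≤ p
Unique⇒length≤ u = injective⇒≤ (Unique⇒lookup-injective u)

complete⇒length≥ : {xs : List (Fin p)} → (∀ v → v ∈ xs) → p ≤ length xs
complete⇒length≥ {p} complete =
  injective⇒≤ (λ {v} {w} → SetoidMembership.index-injective (setoid (Fin p)) (complete v) (complete w))

length-filter-split : {P : A → Set} (P? : ∀ x → Dec (P x)) (xs : List A) →
  length xs ≡ length (filter P? xs) + length (filter (¬? ∘ P?) xs)
length-filter-split P? [] = refl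
length-filter-split P? (x ∷ xs) with P? x
... | yes _ = cong suc (length-filter-split P? xs)
... | no _  = trans (cong suc (length-filter-split P? xs)) (sym (+-suc _ _))

length-allFin : ∀ n → length (allFin n) ≡ n
length-allFin n = length-tabulate id

sum-map-const : (k : ℕ) (xs : List A) → sum (map (λ _ → k) xs) ≡ length xs * k
sum-map-const k []       = refl
sum-map-const k (x ∷ xs) = cong (k +_) (sum-map-const k xs)

length≤sum-classes : (_≟_ : DecidableEquality B) (c : A → B) (K : B → ℕ) (bs : List B) (xs : List A) →
  All (λ x → c x ∈ bs) xs →
  (∀ b ys → ys ⊆ xs → All (λ y → c y ≡ b) ys → length ys ≤ K b) →
  length xs ≤ sum (map K bs)
length≤sum-classes _≟_ c K []       []      _ _ = z≤n
length≤sum-classes _≟_ c K []       (_ ∷ _) (() ∷ _) _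
length≤sum-classes _≟_ c K (b ∷ bs) xs classified bound = begin
  length xs                                 ≡⟨ length-filter-split inClass? xs ⟩
  length (filter inClass? xs) + length rest ≤⟨ +-mono-≤ inClassBound restBound ⟩
  K b + sum (map K bs)                      ∎
  where
  open ≤-Reasoning
  inClass? = λ x → c x ≟ b
  rest = filter (¬? ∘ inClass?) xs
  rest⊆xs : rest ⊆ xs
  rest⊆xs = filter-⊆ (¬? ∘ inClass?) xs
  restClassified : All (λ x → c x ∈ bs) rest
  restClassified = All.zipWith (λ { (here eq , ne) → ⊥-elim (ne eq) ; (there c∈bs , _) → c∈bs })
                               (All.filter⁺ (¬? ∘ inClass?) classified , All.all-filter (¬? ∘ inClass?) xs)
  inClassBound = bound b _ (filter-⊆ inClass? xs) (All.all-filter inClass? xs)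
  restBound = length≤sum-classes _≟_ c K bs rest restClassified
                                 (λ b′ ys τ → bound b′ ys (⊆-trans τ rest⊆xs))

length≤by-optional-block : {n k₀ k : ℕ} (c : A → Maybe (Fin n)) (xs : List A) →
  (∀ ys → ys ⊆ xs → All (λ y → c y ≡ nothing) ys → length ys ≤ k₀) →
  (∀ i ys → ys ⊆ xs → All (λ y → c y ≡ just i) ys → length ys ≤ k) →
  length xs ≤ k₀ + n * k
length≤by-optional-block {n = n} {k₀} {k} c xs bound₀ bound =
  subst (length xs ≤_) sum-classes
    (length≤sum-classes (≡-dec _≟ᶠ_) c K classes xs (All.universal classified xs) bound′)
  where
  classes = nothing ∷ map just (allFin n)
  K = maybe′ (λ _ → k) k₀
  classified : ∀ x → c x ∈ classes
  classified x with c x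
  ... | nothing = here refl
  ... | just i  = there (∈-map⁺ just (∈-allFin i))
  bound′ : ∀ b ys → ys ⊆ xs → All (λ y → c y ≡ b) ys → length ys ≤ K b
  bound′ nothing  = bound₀
  bound′ (just i) = bound i
  sum-classes : sum (map K classes) ≡ k₀ + n * k
  sum-classes = cong (k₀ +_) (begin
    sum (map K (map just (allFin n)))  ≡⟨ cong sum (map-∘ (allFin n)) ⟨
    sum (map (λ _ → k) (allFin n))     ≡⟨ sum-map-const k (allFin n) ⟩
    length (allFin n) * k              ≡⟨ cong (_* k) (length-allFin n) ⟩
    n * k                              ∎)
    where open ≡-Reasoning

half-≤ : ∀ {l ν} → 2 * l ≤ suc (2 * ν) → l ≤ ν
half-≤ {l} {ν} le = ≤-pred (*-cancelˡ-< 2 l (suc ν) (subst (suc (2 * l) ≤_) (sym (*-suc 2 ν)) (s≤s le)))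

endpoints-map : (f : V → W) (M : List (V × V)) → endpoints (map (Prod.map f f) M) ≡ map f (endpoints M)
endpoints-map f M = trans (concatMap-map (λ e → proj₁ e ∷ proj₂ e ∷ []) (Prod.map f f) M)
                          (sym (map-concatMap f (λ e → proj₁ e ∷ proj₂ e ∷ []) M))

endpoints-++ : (M N : List (V × V)) → endpoints (M ++ N) ≡ endpoints M ++ endpoints N
endpoints-++ = concatMap-++ (λ e → proj₁ e ∷ proj₂ e ∷ [])

length-endpoints : (M : List (V × V)) → length (endpoints M) ≡ 2 * length M
length-endpoints []      = refl
length-endpoints (e ∷ M) = trans (cong (2 +_) (length-endpoints M)) (sym (*-suc 2 (length M)))

endpoints-⊆ : {M N : List (V × V)} → M ⊆ N → endpoints M ⊆ endpoints N
endpoints-⊆ []         = []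
endpoints-⊆ (e ∷ʳ τ)   = proj₁ e ∷ʳ (proj₂ e ∷ʳ endpoints-⊆ τ)
endpoints-⊆ (refl ∷ τ) = refl ∷ (refl ∷ endpoints-⊆ τ)

size≤order : (G : FinGraph p) {M : List (Fin p × Fin p)} → IsMatching G M → 2 * length M ≤ p
size≤order G {M} (_ , uniq) = subst (_≤ _) (length-endpoints M) (Unique⇒length≤ uniq)

size≤half-order : (G : FinGraph (suc p)) {ν : ℕ} → p ≤ 2 * ν →
                  {M : List (Fin (suc p) × Fin (suc p))} → IsMatching G M → length M ≤ ν
size≤half-order G p≤2ν matching = half-≤ (≤-trans (size≤order G matching) (s≤s p≤2ν))

module _ (G : SimpleGraph V) where

  IsMatching-⊆ : {M N : List (V × V)} → M ⊆ N → IsMatching G N → IsMatching G M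
  IsMatching-⊆ τ (adj , uniq) = All-resp-⊆ τ adj , Unique-resp-⊇ (endpoints-⊆ τ) uniq

  IsMatching-++ : {M N : List (V × V)} → IsMatching G M → IsMatching G N →
                  Disjoint (endpoints M) (endpoints N) → IsMatching G (M ++ N)
  IsMatching-++ {M} {N} (adjM , uniqM) (adjN , uniqN) disjoint =
    All.++⁺ adjM adjN , subst Unique (sym (endpoints-++ M N)) (Unique.++⁺ uniqM uniqN disjoint)

  module _ (G′ : SimpleGraph W) (f : V → W) where

    IsMatching-map⁺ : (∀ {a b} → f a ≡ f b → a ≡ b) → (∀ {a b} → Adj G a b → Adj G′ (f a) (f b)) →
                      {M : List (V × V)} → IsMatching G M → IsMatching G′ (map (Prod.map f f) M)
    IsMatching-map⁺ injective hom {M} (adj , uniq) =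
      All.map⁺ (All.map hom adj) , subst Unique (sym (endpoints-map f M)) (Unique.map⁺ injective uniq)

    IsMatching-map⁻ : (∀ {a b} → Adj G′ (f a) (f b) → Adj G a b) →
                      {M : List (V × V)} → IsMatching G′ (map (Prod.map f f) M) → IsMatching G M
    IsMatching-map⁻ reflects {M} (adj , uniq) =
      All.map reflects (All.map⁻ adj) , Unique.map⁻ (subst Unique (endpoints-map f M) uniq)

    pullback-size≤ : (∀ {a b} → Adj G′ (f a) (f b) → Adj G a b) →
      {ν : ℕ} → (∀ N → IsMatching G N → length N ≤ ν) →
      {M : List (W × W)} → IsMatching G′ M → All (λ e → ∃[ d ] Prod.map f f d ≡ e) M → length M ≤ ν
    pullback-size≤ reflects bound matching preimages with map-preimage (Prod.map f f) preimages
    ... | N , refl = subst (_≤ _) (sym (length-map _ N)) (bound N (IsMatching-map⁻ reflects matching))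

Meets : (I → V) → V × V → Set
Meets ι e = ∃[ a ] (ι a ≡ proj₁ e ⊎ ι a ≡ proj₂ e)

length-reduce : {P : A → Set} (f : ∀ {x} → P x → B) {xs : List A} (ps : All P xs) →
                length (All.reduce f ps) ≡ length xs
length-reduce f []       = refl
length-reduce f (_ ∷ ps) = cong suc (length-reduce f ps)

meeting-points-⊆ : (ι : I → V) {M : List (V × V)} (ms : All (Meets ι) M) →
                   map ι (All.reduce proj₁ ms) ⊆ endpoints M
meeting-points-⊆ ι []                 = []
meeting-points-⊆ ι ((_ , inj₁ eq) ∷ ms) = eq ∷ (_ ∷ʳ meeting-points-⊆ ι ms)
meeting-points-⊆ ι ((_ , inj₂ eq) ∷ ms) = _ ∷ʳ (eq ∷ meeting-points-⊆ ι ms)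

meeting-≤ : (G : SimpleGraph V) (ι : Fin p → V) {M : List (V × V)} →
            IsMatching G M → All (Meets ι) M → length M ≤ p
meeting-≤ {p = p} G ι (_ , uniq) ms = subst (_≤ p) (length-reduce proj₁ ms)
  (Unique⇒length≤ (Unique.map⁻ (Unique-resp-⊇ (meeting-points-⊆ ι ms) uniq)))

perfect⇒order≤2ν : (G : FinGraph p) {ν : ℕ} → HasPerfectMatching G →
                   (∀ M → IsMatching G M → length M ≤ ν) → p ≤ 2 * ν
perfect⇒order≤2ν {p} G {ν} (P , matching , saturated) maximum = begin
  p                       ≤⟨ complete⇒length≥ saturated ⟩
  length (endpoints P)    ≡⟨ length-endpoints P ⟩
  2 * length P            ≤⟨ *-monoʳ-≤ 2 (maximum P matching) ⟩
  2 * ν                   ∎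
  where open ≤-Reasoning

unsaturated : (G : FinGraph p) {M : List (Fin p × Fin p)} → ¬ HasPerfectMatching G →
              IsMatching G M → ∃[ u ] u ∉ endpoints M
unsaturated {p} G {M} imperfect matching =
  ¬∀⟶∃¬ p (_∈ endpoints M) (λ v → DecMembership._∈?_ _≟ᶠ_ v (endpoints M))
          (λ saturated → imperfect (M , matching , saturated))

copies : (I → V → W) → List I → List (V × V) → List (W × W)
copies f = cartesianProductWith (λ i → Prod.map (f i) (f i))

endpoints-copies : (f : I → V → W) (is : List I) (N : List (V × V)) →
                   endpoints (copies f is N) ≡ cartesianProductWith f is (endpoints N)
endpoints-copies f []       N = refl
endpoints-copies f (i ∷ is) N = begin
  endpoints (map (Prod.map (f i) (f i)) N ++ copies f is N)
    ≡⟨ endpoints-++ (map (Prod.map (f i) (f i)) N) (copies f is N) ⟩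
  endpoints (map (Prod.map (f i) (f i)) N) ++ endpoints (copies f is N)
    ≡⟨ cong₂ _++_ (endpoints-map (f i) N) (endpoints-copies f is N) ⟩
  map (f i) (endpoints N) ++ cartesianProductWith f is (endpoints N)
    ∎
  where open ≡-Reasoning

length-copies : (f : I → V → W) (is : List I) (N : List (V × V)) →
                length (copies f is N) ≡ length is * length N
length-copies f []       N = refl
length-copies f (i ∷ is) N = trans (length-++ (map (Prod.map (f i) (f i)) N))
                                   (cong₂ _+_ (length-map _ N) (length-copies f is N))

IsMatching-copies : (G : SimpleGraph V) (G′ : SimpleGraph W) (f : I → V → W) →
  (∀ {i j a b} → f i a ≡ f j b → i ≡ j × a ≡ b) →
  (∀ i {a b} → Adj G a b → Adj G′ (f i a) (f i b)) →
  {is : List I} {N : List (V × V)} → Unique is → IsMatching G N → IsMatching G′ (copies f is N)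
IsMatching-copies G G′ f injective hom {is} {N} uniqueIs (adj , uniq) = adjacent is , unique
  where
  adjacent : ∀ is → All (λ e → Adj G′ (proj₁ e) (proj₂ e)) (copies f is N)
  adjacent []       = []
  adjacent (i ∷ is) = All.++⁺ (All.map⁺ (All.map (hom i) adj)) (adjacent is)
  unique : Unique (endpoints (copies f is N))
  unique = subst Unique (sym (endpoints-copies f is N))
                 (Unique.cartesianProductWith⁺ f injective uniqueIs uniq)

-- The cone over a graph, with apex zero

coneAdj : ∀ {m} → FinGraph m → Fin (suc m) → Fin (suc m) → Set
coneAdj H zero    zero    = ⊥
coneAdj H zero    (suc _) = ⊤
coneAdj H (suc _) zero    = ⊤
coneAdj H (suc a) (suc b) = Adj H a b

coneSym : ∀ {m} (H : FinGraph m) {a b} → coneAdj H a b → coneAdj H b a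
coneSym H {zero}  {suc _} _   = tt
coneSym H {suc _} {zero}  _   = tt
coneSym H {suc _} {suc _} adj = adjSym H adj

coneIrrefl : ∀ {m} (H : FinGraph m) {a} → ¬ coneAdj H a a
coneIrrefl H {suc _} adj = irrefl H adj

cone : ∀ {m} → FinGraph m → FinGraph (suc m)
cone H = record
  { Adj    = coneAdj H
  ; adjSym = λ {a} {b} → coneSym H {a} {b}
  ; irrefl = λ {a} → coneIrrefl H {a}
  }

withApexEdge : ∀ {m} → Fin m → List (Fin m × Fin m) → List (Fin (suc m) × Fin (suc m))
withApexEdge u M = (zero , suc u) ∷ map (Prod.map suc suc) M

withApexEdge-isMatching : ∀ {m} {H : FinGraph m} {u} {M} → u ∉ endpoints M → IsMatching H M →
                          IsMatching (cone H) (withApexEdge u M)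
withApexEdge-isMatching {H = H} {u} {M} u∉M matching
  with IsMatching-map⁺ H (cone H) suc suc-injective id matching
... | adj , uniq = (tt ∷ adj) , ((λ ()) ∷ apexFresh) ∷ uFresh ∷ uniq
  where
  sucEndpoints = sym (endpoints-map suc M)
  apexFresh : All (zero ≢_) (endpoints (map (Prod.map suc suc) M))
  apexFresh = subst (All (zero ≢_)) sucEndpoints (All.map⁺ (All.universal (λ _ ()) (endpoints M)))
  uFresh : All (suc u ≢_) (endpoints (map (Prod.map suc suc) M))
  uFresh = subst (All (suc u ≢_)) sucEndpoints
             (All.map⁺ (All.map (λ u≢v → u≢v ∘ suc-injective) (All.¬Any⇒All¬ _ u∉M)))

module Corona {n m : ℕ} (G : FinGraph n) (H : FinGraph m) where

  Vertex : Set
  Vertex = Fin n ⊎ (Fin n × Fin m)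

  Edge : Set
  Edge = Vertex × Vertex

  G∘H : SimpleGraph Vertex
  G∘H = corona G H

  copyVertex : Fin n → Fin m → Vertex
  copyVertex k h = inj₂ (k , h)

  -- The block {g_k} ∪ H_k, as the cone over H with apex g_k.
  blockVertex : Fin n → Fin (suc m) → Vertex
  blockVertex k zero    = inj₁ k
  blockVertex k (suc h) = inj₂ (k , h)

  copyVertex-injective : ∀ {i j a b} → copyVertex i a ≡ copyVertex j b → i ≡ j × a ≡ b
  copyVertex-injective refl = refl , refl

  blockVertex-injective : ∀ {i j a b} → blockVertex i a ≡ blockVertex j b → i ≡ j × a ≡ b
  blockVertex-injective {a = zero}  {zero}  refl = refl , refl
  blockVertex-injective {a = suc _} {suc _} refl = refl , refl

  blockVertex-hom : ∀ k {a b} → coneAdj H a b → Adj G∘H (blockVertex k a) (blockVertex k b)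
  blockVertex-hom k {zero}  {suc _} _   = refl
  blockVertex-hom k {suc _} {zero}  _   = refl
  blockVertex-hom k {suc _} {suc _} adj = refl , adj

  blockVertex-reflects : ∀ k {a b} → Adj G∘H (blockVertex k a) (blockVertex k b) → coneAdj H a b
  blockVertex-reflects k {zero}  {zero}  adj = irrefl G adj
  blockVertex-reflects k {zero}  {suc _} _   = tt
  blockVertex-reflects k {suc _} {zero}  _   = tt
  blockVertex-reflects k {suc _} {suc _} adj = proj₂ adj

  EdgeAdj : Edge → Set
  EdgeAdj e = Adj G∘H (proj₁ e) (proj₂ e)

  hostBlock : Edge → Maybe (Fin n)
  hostBlock (inj₁ _ , inj₁ _)       = nothing
  hostBlock (inj₁ _ , inj₂ (k , _)) = just k
  hostBlock (inj₂ (k , _) , _)      = just k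

  hostBlock-nothing : ∀ {e} → hostBlock e ≡ nothing → ∃[ d ] Prod.map inj₁ inj₁ d ≡ e
  hostBlock-nothing {inj₁ a , inj₁ b} _ = (a , b) , refl

  hostBlock-just : ∀ {k e} → EdgeAdj e × hostBlock e ≡ just k →
                   ∃[ d ] Prod.map (blockVertex k) (blockVertex k) d ≡ e
  hostBlock-just {e = inj₁ _ , inj₂ (_ , h)}      (refl , refl)       = (zero , suc h) , refl
  hostBlock-just {e = inj₂ (_ , h) , inj₁ _}      (refl , refl)       = (suc h , zero) , refl
  hostBlock-just {e = inj₂ (_ , h) , inj₂ (_ , h′)} ((refl , _) , refl) = (suc h , suc h′) , refl

  upper-perfect : {νG νH : ℕ} → (∀ M → IsMatching G M → length M ≤ νG) → m ≤ 2 * νH →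
                  {M : List Edge} → IsMatching G∘H M → length M ≤ νG + n * νH
  upper-perfect maximumG m≤2νH {M} matching = length≤by-optional-block hostBlock M inG inBlock
    where
    inG : ∀ ys → ys ⊆ M → All (λ e → hostBlock e ≡ nothing) ys → length ys ≤ _
    inG ys τ classified =
      pullback-size≤ G G∘H inj₁ id maximumG (IsMatching-⊆ G∘H τ matching)
                     (All.map hostBlock-nothing classified)
    inBlock : ∀ k ys → ys ⊆ M → All (λ e → hostBlock e ≡ just k) ys → length ys ≤ _
    inBlock k ys τ classified =
      pullback-size≤ (cone H) G∘H (blockVertex k) (λ {a} {b} → blockVertex-reflects k {a} {b})
                     (λ _ → size≤half-order (cone H) m≤2νH) matchingYs
                     (All.zipWith hostBlock-just (proj₁ matchingYs , classified))
      where matchingYs = IsMatching-⊆ G∘H τ matching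

  copyOf : Edge → Maybe (Fin n)
  copyOf (inj₂ (k , _) , inj₂ _) = just k
  copyOf (inj₂ _ , inj₁ _)       = nothing
  copyOf (inj₁ _ , _)            = nothing

  copyOf-nothing : ∀ {e} → copyOf e ≡ nothing → Meets inj₁ e
  copyOf-nothing {inj₁ a , _}      _ = a , inj₁ refl
  copyOf-nothing {inj₂ _ , inj₁ a} _ = a , inj₂ refl

  copyOf-just : ∀ {k e} → EdgeAdj e × copyOf e ≡ just k →
                ∃[ d ] Prod.map (copyVertex k) (copyVertex k) d ≡ e
  copyOf-just {e = inj₂ (_ , h) , inj₂ (_ , h′)} ((refl , _) , refl) = (h , h′) , refl

  upper-imperfect : {νH : ℕ} → (∀ M → IsMatching H M → length M ≤ νH) →
                    {M : List Edge} → IsMatching G∘H M → length M ≤ n + n * νH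
  upper-imperfect maximumH {M} matching = length≤by-optional-block copyOf M meetingG inCopy
    where
    meetingG : ∀ ys → ys ⊆ M → All (λ e → copyOf e ≡ nothing) ys → length ys ≤ n
    meetingG ys τ classified =
      meeting-≤ G∘H inj₁ (IsMatching-⊆ G∘H τ matching) (All.map copyOf-nothing classified)
    inCopy : ∀ k ys → ys ⊆ M → All (λ e → copyOf e ≡ just k) ys → length ys ≤ _
    inCopy k ys τ classified =
      pullback-size≤ H G∘H (copyVertex k) proj₂ maximumH matchingYs
                     (All.zipWith copyOf-just (proj₁ matchingYs , classified))
      where matchingYs = IsMatching-⊆ G∘H τ matching

  lower-perfect : ∀ {MG MH} → IsMatching G MG → IsMatching H MH →
                  ∃[ M ] IsMatching G∘H M × length M ≡ length MG + n * length MH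
  lower-perfect {MG} {MH} matchingG matchingH = edgesG ++ edgesCopies , matching , size
    where
    edgesG = map (Prod.map inj₁ inj₁) MG
    edgesCopies = copies copyVertex (allFin n) MH
    disjoint : Disjoint (endpoints edgesG) (endpoints edgesCopies)
    disjoint {v} (v∈G , v∈copies)
      with ∈-map⁻ inj₁ (subst (v ∈_) (endpoints-map inj₁ MG) v∈G)
         | ∈-cartesianProductWith⁻ copyVertex (allFin n) (endpoints MH)
             (subst (v ∈_) (endpoints-copies copyVertex (allFin n) MH) v∈copies)
    ... | _ , _ , refl | _ , _ , _ , _ , ()
    matching : IsMatching G∘H (edgesG ++ edgesCopies)
    matching = IsMatching-++ G∘H
      (IsMatching-map⁺ G G∘H inj₁ (λ { refl → refl }) id matchingG)
      (IsMatching-copies H G∘H copyVertex copyVertex-injective (λ _ adj → refl , adj)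
                         (Unique.allFin⁺ n) matchingH)
      disjoint
    size : length (edgesG ++ edgesCopies) ≡ length MG + n * length MH
    size = trans (length-++ edgesG)
                 (cong₂ _+_ (length-map _ MG)
                            (trans (length-copies copyVertex (allFin n) MH)
                                   (cong (_* length MH) (length-allFin n))))

  lower-imperfect : ∀ {u MH} → u ∉ endpoints MH → IsMatching H MH →
                    ∃[ M ] IsMatching G∘H M × length M ≡ n + n * length MH
  lower-imperfect {u} {MH} u∉MH matchingH = copies blockVertex (allFin n) (withApexEdge u MH) , matching , size
    where
    matching = IsMatching-copies (cone H) G∘H blockVertex blockVertex-injective
                                 (λ k {a} {b} → blockVertex-hom k {a} {b}) (Unique.allFin⁺ n)
                                 (withApexEdge-isMatching u∉MH matchingH)
    size = trans (length-copies blockVertex (allFin n) (withApexEdge u MH))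
                 (trans (cong₂ _*_ (length-allFin n) (cong suc (length-map _ MH))) (*-suc n (length MH)))

mainTheorem1 : ∀ {n m} (G : FinGraph n) (H : FinGraph m) (νG νH : ℕ) →
    IsMatchingNumber G νG → IsMatchingNumber H νH →
    (HasPerfectMatching H → IsMatchingNumber (corona G H) (νG + n * νH)) ×
    (¬ HasPerfectMatching H → IsMatchingNumber (corona G H) (n + n * νH))
mainTheorem1 G H _ _ ((MG , matchingG , refl) , maximumG) ((MH , matchingH , refl) , maximumH) =
  perfect , imperfect
  where
  open Corona G H
  perfect : HasPerfectMatching H → IsMatchingNumber G∘H _
  perfect perfectH =
    lower-perfect matchingG matchingH ,
    λ _ → upper-perfect maximumG (perfect⇒order≤2ν H perfectH maximumH)
  imperfect : ¬ HasPerfectMatching H → IsMatchingNumber G∘H _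
  imperfect imperfectH =
    lower-imperfect (proj₂ (unsaturated H imperfectH matchingH)) matchingH ,
    λ _ → upper-imperfect maximumH
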